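{- Let $q$ be a prime power and let $\mathcal{F}\subseteq 2^{[n]}$ be such that $|A\setminus B|\not\equiv 0\pmod q$ for any distinct $A,B\in\mathcal{F}$. Then $$|\mathcal{F}|\le\sum_{i=0}^{q-1}\binom{n-1}{i}.$$
   Context: $n$ is a positive integer, $[n]=\{1,\ldots,n\}$, and $2^{[n]}$ is the family of all subsets of $[n]$. -}

module Defs where

open import Data.Nat using (ℕ; suc; _^_)
open import Data.Nat.Primality using (Prime)
open import Data.Nat.Combinatorics using (_C_)
open import Data.List using (List; map; upTo)
open import Data.Nat.ListAction using (sum)
open import Data.Product using (∃₂; _×_)
open import Relation.Binary.PropositionalEquality using (_≡_)

IsPrimePower : ℕ → Set
IsPrimePower q = ∃₂ λ p k → Prime p × q ≡ p ^ suc k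

binomSum : ℕ → ℕ → ℕ
binomSum m q = sum (map (λ i → m C i) (upTo q))

-- Absorption, t · C(t − 1, q − 1) = q · C(t, q), shows p ∣ C(t − 1, q − 1) whenever
-- t ≥ 1 and q ∤ t.  The alternating sum g(t) = Σ_{j<q} (−1)^(q−1−j) C(t, j) equals C(t − 1, q − 1)
-- for t ≥ 1 and ±1 at t = 0, and both x ↦ g(|A′ ─ x|) and x ↦ g(|x ─ A′|) are multilinear
-- polynomials of degree < q.  Writing A = (a₀, A′) for A ∈ F, let f_A be the first if a₀ = 0 and the
-- second if a₀ = 1; then f_A(B′) is g(|A ─ B|) or g(|B ─ A|), so the matrix (f_A(B′)) is diagonal
-- with unit diagonal mod p.  Hence the f_A are linearly independent over 𝔽ₚ in a space of
-- dimension Σ_{i<q} C(n − 1, i).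

module Submission where

open import Defs
open import Data.Nat using (ℕ; suc; _≤_; _∸_)
open import Data.Nat.Divisibility using (_∣_)
open import Data.Fin.Subset using (Subset; _─_; ∣_∣)
open import Data.List using (List; length)
open import Data.List.Membership.Propositional using (_∈_)
open import Data.List.Relation.Unary.Unique.Propositional using (Unique)
open import Relation.Binary.PropositionalEquality using (_≡_)
open import Relation.Nullary using (¬_)

open import Data.Nat as ℕ using (zero; _^_; z≤n; s≤s; NonZero)
open import Data.Nat.Properties as ℕ using (m^n≡0⇒m≡0)
open import Data.Nat.Combinatorics using (_C_; nC1≡n; nCk+nC[k+1]≡[n+1]C[k+1])
open import Data.Nat.Divisibility using (_∣?_; divides; _∣0; 1∣_; ∣1⇒≡1; ∣-trans; m∣m*n; *-monoʳ-∣; *-cancelˡ-∣)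
open import Data.Nat.Primality using (Prime; euclidsLemma; prime⇒nonZero; ¬prime[0]; ¬prime[1])
open import Data.Nat.ListAction using (sum)
open import Data.Nat.ListAction.Properties using (sum-++)
import Data.Nat.Tactic.RingSolver as ℕ-Solver
open import Data.Integer as ℤ using (ℤ; +_; _+_; _-_; _*_; -_; 0ℤ; 1ℤ)
open import Data.Integer.Properties
  using (pos-+; abs-*; ∣-i∣≡∣i∣; +-identityˡ; +-identityʳ; +-comm; +-assoc; *-identityˡ; *-identityʳ; *-zeroʳ; +-*-semiring)
open import Data.Integer.Divisibility.Signed
  using (∣ᵤ⇒∣; ∣⇒∣ᵤ; ∣m∣n⇒∣m+n; ∣m∣n⇒∣m-n; ∣m⇒∣m*n; ∣n⇒∣m*n; ∣m+n∣n⇒∣m; ∣m⇒∣-m)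
  renaming (_∣_ to _∣ℤ_; _∣?_ to _∣ℤ?_)
open import Data.Integer.Tactic.RingSolver using (solve-∀)
open import Algebra.Properties.Semiring.Sum +-*-semiring using (sum-remove; sum-cong-≗; ∑-distrib-+; *-distribˡ-sum)
  renaming (sum to ∑)
open import Data.Bool using (Bool; true; false)
open import Data.Unit using (⊤; tt)
open import Data.Product using (∃; _×_; _,_)
open import Data.Sum using (_⊎_; inj₁; inj₂; reduce)
open import Data.Fin using (Fin; zero; suc)
open import Data.Fin.Properties using (suc-injective)
open import Data.Vec as Vec using (Vec; []; _∷_; _++_)
open import Data.Vec.Functional using (Vector; removeAt)
open import Data.List as List using ([_]; _∷ʳ_; upTo)
open import Data.List.Properties using (map-++; applyUpTo-∷ʳ)
open import Data.List.Relation.Unary.All as All using ()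
open import Data.List.Relation.Unary.AllPairs using (_∷_)
open import Data.List.Membership.Propositional.Properties using (∈-lookup)
open import Function using (id; _∘_)
open import Relation.Nullary using (yes; no; contradiction)
open import Relation.Binary.PropositionalEquality using (_≢_; refl; sym; trans; cong; cong₂; subst; module ≡-Reasoning)
open ≡-Reasoning

C-absorption : ∀ s r → suc s ℕ.* (s C r) ≡ suc r ℕ.* (suc s C suc r)
C-absorption s zero = begin
  suc s ℕ.* 1        ≡⟨ ℕ.*-identityʳ (suc s) ⟩
  suc s              ≡⟨ nC1≡n (suc s) ⟨
  suc s C 1          ≡⟨ ℕ.*-identityˡ (suc s C 1) ⟨
  1 ℕ.* (suc s C 1)  ∎
C-absorption zero (suc r) = sym (ℕ.*-zeroʳ (suc (suc r)))
C-absorption (suc s) (suc r) = begin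
  suc (suc s) ℕ.* d
    ≡⟨ ℕ.+-comm d (suc s ℕ.* d) ⟩
  suc s ℕ.* d ℕ.+ d
    ≡⟨ cong (λ e → suc s ℕ.* e ℕ.+ d) (nCk+nC[k+1]≡[n+1]C[k+1] s r) ⟨
  suc s ℕ.* (s C r ℕ.+ s C suc r) ℕ.+ d
    ≡⟨ cong (ℕ._+ d) (ℕ.*-distribˡ-+ (suc s) (s C r) (s C suc r)) ⟩
  suc s ℕ.* (s C r) ℕ.+ suc s ℕ.* (s C suc r) ℕ.+ d
    ≡⟨ cong₂ (λ a b → a ℕ.+ b ℕ.+ d) (C-absorption s r) (C-absorption s (suc r)) ⟩
  suc r ℕ.* d ℕ.+ suc (suc r) ℕ.* c ℕ.+ d
    ≡⟨ collect r d c ⟩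
  suc (suc r) ℕ.* (d ℕ.+ c)
    ≡⟨ cong (suc (suc r) ℕ.*_) (nCk+nC[k+1]≡[n+1]C[k+1] (suc s) (suc r)) ⟩
  suc (suc r) ℕ.* (suc (suc s) C suc (suc r)) ∎
  where
  d c : ℕ
  d = suc s C suc r
  c = suc s C suc (suc r)
  collect : ∀ r d c → suc r ℕ.* d ℕ.+ suc (suc r) ℕ.* c ℕ.+ d ≡ suc (suc r) ℕ.* (d ℕ.+ c)
  collect = ℕ-Solver.solve-∀

prime^∣m*n⇒∣m : ∀ {p} → Prime p → ∀ e {m n} → p ^ e ∣ m ℕ.* n → ¬ p ∣ n → p ^ e ∣ m
prime^∣m*n⇒∣m p-prime zero _ _ = 1∣ _
prime^∣m*n⇒∣m {p} p-prime (suc e) {m} {n} p^[1+e]∣mn p∤n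
  with euclidsLemma m n p-prime (∣-trans (m∣m*n (p ^ e)) p^[1+e]∣mn)
... | inj₂ p∣n = contradiction p∣n p∤n
... | inj₁ (divides m′ refl) =
  subst (p ^ suc e ∣_) (ℕ.*-comm p m′) (*-monoʳ-∣ p (prime^∣m*n⇒∣m p-prime e p^e∣m′n p∤n))
  where
  instance
    p≢0 : NonZero p
    p≢0 = prime⇒nonZero p-prime
  regroup : ∀ m′ p n → m′ ℕ.* p ℕ.* n ≡ p ℕ.* (m′ ℕ.* n)
  regroup = ℕ-Solver.solve-∀
  p^e∣m′n : p ^ e ∣ m′ ℕ.* n
  p^e∣m′n = *-cancelˡ-∣ p (subst (p ^ suc e ∣_) (regroup m′ p n) p^[1+e]∣mn)

q∤1+s⇒p∣sC[q∸1] : ∀ {p k r s} → Prime p → suc r ≡ p ^ suc k → ¬ suc r ∣ suc s → p ∣ s C r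
q∤1+s⇒p∣sC[q∸1] {p} {k} {r} {s} p-prime q≡p^[1+k] q∤1+s with p ∣? s C r
... | yes p∣sCr = p∣sCr
... | no  p∤sCr = contradiction (subst (_∣ suc s) (sym q≡p^[1+k]) p^[1+k]∣1+s) q∤1+s
  where
  q∣[1+s]*sCr : suc r ∣ suc s ℕ.* (s C r)
  q∣[1+s]*sCr = subst (suc r ∣_) (sym (C-absorption s r)) (m∣m*n _)
  p^[1+k]∣1+s : p ^ suc k ∣ suc s
  p^[1+k]∣1+s = prime^∣m*n⇒∣m p-prime (suc k) (subst (_∣ suc s ℕ.* (s C r)) q≡p^[1+k] q∣[1+s]*sCr) p∤sCr

altBinomSum : ℕ → ℕ → ℤ
altBinomSum zero    t = + (t C 0)
altBinomSum (suc r) t = + (t C suc r) - altBinomSum r t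

altBinomSum-suc : ∀ r s → altBinomSum r (suc s) ≡ + (s C r)
altBinomSum-suc zero    s = refl
altBinomSum-suc (suc r) s = begin
  + (suc s C suc r) - altBinomSum r (suc s)  ≡⟨ cong₂ _-_ (cong +_ (sym (nCk+nC[k+1]≡[n+1]C[k+1] s r))) (altBinomSum-suc r s) ⟩
  + (s C r ℕ.+ s C suc r) - + (s C r)        ≡⟨ cong (_- + (s C r)) (pos-+ (s C r) (s C suc r)) ⟩
  + (s C r) + + (s C suc r) - + (s C r)      ≡⟨ cancel (+ (s C r)) (+ (s C suc r)) ⟩
  + (s C suc r)                              ∎
  where
  cancel : ∀ a b → a + b - a ≡ b
  cancel = solve-∀

∣altBinomSum-zero∣≡1 : ∀ r → ℤ.∣ altBinomSum r 0 ∣ ≡ 1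
∣altBinomSum-zero∣≡1 zero    = refl
∣altBinomSum-zero∣≡1 (suc r) = begin
  ℤ.∣ 0ℤ - altBinomSum r 0 ∣  ≡⟨ cong ℤ.∣_∣ (+-identityˡ (- altBinomSum r 0)) ⟩
  ℤ.∣ - altBinomSum r 0 ∣     ≡⟨ ∣-i∣≡∣i∣ (altBinomSum r 0) ⟩
  ℤ.∣ altBinomSum r 0 ∣       ≡⟨ ∣altBinomSum-zero∣≡1 r ⟩
  1                           ∎

-- Multilinear polynomials of degree < d in n variables (enough for evaluation at 0/1-points);
-- a pair (p₀ , p₁) stands for p₀ + x₀ p₁.
Poly : ℕ → ℕ → Set
Poly n       zero    = ⊤
Poly zero    (suc d) = ℤ
Poly (suc n) (suc d) = Poly n (suc d) × Poly n d

indicator : Bool → ℤ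
indicator true  = 1ℤ
indicator false = 0ℤ

⟦_⟧ : ∀ {n d} → Poly n d → Subset n → ℤ
⟦_⟧ {d = zero}      _         _       = 0ℤ
⟦_⟧ {zero}  {suc d} c         []      = c
⟦_⟧ {suc n} {suc d} (p₀ , p₁) (b ∷ x) = ⟦ p₀ ⟧ x + indicator b * ⟦ p₁ ⟧ x

0ᴾ : ∀ {n d} → Poly n d
0ᴾ {d = zero}      = tt
0ᴾ {zero}  {suc d} = 0ℤ
0ᴾ {suc n} {suc d} = 0ᴾ , 0ᴾ

infixl 6 _+ᴾ_
_+ᴾ_ : ∀ {n d} → Poly n d → Poly n d → Poly n d
_+ᴾ_ {d = zero}      _         _         = tt
_+ᴾ_ {zero}  {suc d} p         q         = p + q
_+ᴾ_ {suc n} {suc d} (p₀ , p₁) (q₀ , q₁) = p₀ +ᴾ q₀ , p₁ +ᴾ q₁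

-ᴾ_ : ∀ {n d} → Poly n d → Poly n d
-ᴾ_ {d = zero}      _         = tt
-ᴾ_ {zero}  {suc d} p         = - p
-ᴾ_ {suc n} {suc d} (p₀ , p₁) = -ᴾ p₀ , -ᴾ p₁

raise : ∀ {n d} → Poly n d → Poly n (suc d)
raise {d = zero}      _         = 0ᴾ
raise {zero}  {suc d} p         = p
raise {suc n} {suc d} (p₀ , p₁) = raise p₀ , raise p₁

⟦0ᴾ⟧ : ∀ {n d} (x : Subset n) → ⟦ 0ᴾ {n} {d} ⟧ x ≡ 0ℤ
⟦0ᴾ⟧ {d = zero}      x       = refl
⟦0ᴾ⟧ {zero}  {suc d} []      = refl
⟦0ᴾ⟧ {suc n} {suc d} (b ∷ x) rewrite ⟦0ᴾ⟧ {n} {suc d} x | ⟦0ᴾ⟧ {n} {d} x = absorb (indicator b)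
  where
  absorb : ∀ i → 0ℤ + i * 0ℤ ≡ 0ℤ
  absorb = solve-∀

⟦+ᴾ⟧ : ∀ {n d} (p q : Poly n d) x → ⟦ p +ᴾ q ⟧ x ≡ ⟦ p ⟧ x + ⟦ q ⟧ x
⟦+ᴾ⟧ {d = zero}      p         q         x       = refl
⟦+ᴾ⟧ {zero}  {suc d} p         q         []      = refl
⟦+ᴾ⟧ {suc n} {suc d} (p₀ , p₁) (q₀ , q₁) (b ∷ x) rewrite ⟦+ᴾ⟧ p₀ q₀ x | ⟦+ᴾ⟧ p₁ q₁ x =
  regroup (⟦ p₀ ⟧ x) (⟦ q₀ ⟧ x) (⟦ p₁ ⟧ x) (⟦ q₁ ⟧ x) (indicator b)
  where
  regroup : ∀ a a′ c c′ i → a + a′ + i * (c + c′) ≡ a + i * c + (a′ + i * c′)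
  regroup = solve-∀

⟦-ᴾ⟧ : ∀ {n d} (p : Poly n d) x → ⟦ -ᴾ p ⟧ x ≡ - ⟦ p ⟧ x
⟦-ᴾ⟧ {d = zero}      p         x       = refl
⟦-ᴾ⟧ {zero}  {suc d} p         []      = refl
⟦-ᴾ⟧ {suc n} {suc d} (p₀ , p₁) (b ∷ x) rewrite ⟦-ᴾ⟧ p₀ x | ⟦-ᴾ⟧ p₁ x =
  negate (⟦ p₀ ⟧ x) (⟦ p₁ ⟧ x) (indicator b)
  where
  negate : ∀ a c i → - a + i * - c ≡ - (a + i * c)
  negate = solve-∀

⟦raise⟧ : ∀ {n d} (p : Poly n d) x → ⟦ raise p ⟧ x ≡ ⟦ p ⟧ x
⟦raise⟧ {n}     {zero}  p         x       = ⟦0ᴾ⟧ {n} {1} x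
⟦raise⟧ {zero}  {suc d} p         []      = refl
⟦raise⟧ {suc n} {suc d} (p₀ , p₁) (b ∷ x) rewrite ⟦raise⟧ p₀ x | ⟦raise⟧ p₁ x = refl

data Mode : Set where
  ignore present absent : Mode

contribution : Mode → Bool → ℕ
contribution ignore  _     = 0
contribution present true  = 1
contribution present false = 0
contribution absent  true  = 0
contribution absent  false = 1

count : ∀ {n} → Vec Mode n → Subset n → ℕ
count []       []      = 0
count (m ∷ ms) (b ∷ x) = contribution m b ℕ.+ count ms x

C-pred : ℕ → ℕ → ℤ
C-pred t zero    = 0ℤ
C-pred t (suc j) = + (t C j)

C-pascal : ∀ t j → + (suc t C j) ≡ + (t C j) + C-pred t j
C-pascal t zero    = refl
C-pascal t (suc j) = begin
  + (suc t C suc j)          ≡⟨ cong +_ (nCk+nC[k+1]≡[n+1]C[k+1] t j) ⟨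
  + (t C j ℕ.+ t C suc j)    ≡⟨ pos-+ (t C j) (t C suc j) ⟩
  + (t C j) + + (t C suc j)  ≡⟨ +-comm (+ (t C j)) (+ (t C suc j)) ⟩
  + (t C suc j) + + (t C j)  ∎

-- The absent case uses C(t + 1 − b, j) = C(t, j) + C(t, j − 1) − b · C(t, j − 1).
binomPoly  : ∀ {n} j → Vec Mode n → Poly n (suc j)
binomPoly⁻ : ∀ {n} j → Vec Mode n → Poly n j

binomPoly {zero}  j []             = + (0 C j)
binomPoly {suc n} j (ignore  ∷ ms) = binomPoly j ms , 0ᴾ
binomPoly {suc n} j (present ∷ ms) = binomPoly j ms , binomPoly⁻ j ms
binomPoly {suc n} j (absent  ∷ ms) = binomPoly j ms +ᴾ raise (binomPoly⁻ j ms) , -ᴾ binomPoly⁻ j ms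

binomPoly⁻ zero    ms = tt
binomPoly⁻ (suc j) ms = binomPoly j ms

⟦binomPoly⟧  : ∀ {n} j (ms : Vec Mode n) x → ⟦ binomPoly j ms ⟧ x ≡ + (count ms x C j)
⟦binomPoly⁻⟧ : ∀ {n} j (ms : Vec Mode n) x → ⟦ binomPoly⁻ j ms ⟧ x ≡ C-pred (count ms x) j

⟦binomPoly⟧ {zero}  j []             []      = refl
⟦binomPoly⟧ {suc n} j (ignore  ∷ ms) (b ∷ x)
  rewrite ⟦binomPoly⟧ j ms x | ⟦0ᴾ⟧ {n} {j} x = drop (+ (count ms x C j)) (indicator b)
  where
  drop : ∀ u i → u + i * 0ℤ ≡ u
  drop = solve-∀
⟦binomPoly⟧ {suc n} j (present ∷ ms) (b ∷ x)
  rewrite ⟦binomPoly⟧ j ms x | ⟦binomPoly⁻⟧ j ms x = step b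
  where
  t : ℕ
  t = count ms x
  step : ∀ b → + (t C j) + indicator b * C-pred t j ≡ + ((contribution present b ℕ.+ t) C j)
  step true  = trans (cong (_+_ (+ (t C j))) (*-identityˡ (C-pred t j))) (sym (C-pascal t j))
  step false = +-identityʳ (+ (t C j))
⟦binomPoly⟧ {suc n} j (absent ∷ ms) (b ∷ x)
  rewrite ⟦+ᴾ⟧ (binomPoly j ms) (raise (binomPoly⁻ j ms)) x | ⟦raise⟧ (binomPoly⁻ j ms) x
        | ⟦-ᴾ⟧ (binomPoly⁻ j ms) x | ⟦binomPoly⟧ j ms x | ⟦binomPoly⁻⟧ j ms x = step b
  where
  t : ℕ
  t = count ms x
  step : ∀ b → + (t C j) + C-pred t j + indicator b * - C-pred t j ≡ + ((contribution absent b ℕ.+ t) C j)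
  step true  = cancel (+ (t C j)) (C-pred t j)
    where
    cancel : ∀ u v → u + v + 1ℤ * - v ≡ u
    cancel = solve-∀
  step false = trans (+-identityʳ _) (sym (C-pascal t j))

⟦binomPoly⁻⟧ zero    ms x = refl
⟦binomPoly⁻⟧ (suc j) ms x = ⟦binomPoly⟧ j ms x

altBinomPoly : ∀ {n} r → Vec Mode n → Poly n (suc r)
altBinomPoly zero    ms = binomPoly 0 ms
altBinomPoly (suc r) ms = binomPoly (suc r) ms +ᴾ -ᴾ raise (altBinomPoly r ms)

⟦altBinomPoly⟧ : ∀ {n} r (ms : Vec Mode n) x → ⟦ altBinomPoly r ms ⟧ x ≡ altBinomSum r (count ms x)
⟦altBinomPoly⟧ zero    ms x = ⟦binomPoly⟧ 0 ms x
⟦altBinomPoly⟧ (suc r) ms x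
  rewrite ⟦+ᴾ⟧ (binomPoly (suc r) ms) (-ᴾ raise (altBinomPoly r ms)) x | ⟦-ᴾ⟧ (raise (altBinomPoly r ms)) x
        | ⟦raise⟧ (altBinomPoly r ms) x | ⟦binomPoly⟧ (suc r) ms x | ⟦altBinomPoly⟧ r ms x = refl

dim : ℕ → ℕ → ℕ
dim n       zero    = 0
dim zero    (suc d) = 1
dim (suc n) (suc d) = dim n (suc d) ℕ.+ dim n d

binomSum-suc : ∀ m d → binomSum m (suc d) ≡ binomSum m d ℕ.+ m C d
binomSum-suc m d = begin
  sum (List.map (m C_) (upTo (suc d)))             ≡⟨ cong (sum ∘ List.map (m C_)) (applyUpTo-∷ʳ id d) ⟨
  sum (List.map (m C_) (upTo d ∷ʳ d))              ≡⟨ cong sum (map-++ (m C_) (upTo d) [ d ]) ⟩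
  sum (List.map (m C_) (upTo d) List.++ [ m C d ]) ≡⟨ sum-++ (List.map (m C_) (upTo d)) [ m C d ] ⟩
  binomSum m d ℕ.+ (m C d ℕ.+ 0)                   ≡⟨ cong (binomSum m d ℕ.+_) (ℕ.+-identityʳ (m C d)) ⟩
  binomSum m d ℕ.+ m C d                           ∎

binomSum-pascal : ∀ m d → binomSum (suc m) (suc d) ≡ binomSum m (suc d) ℕ.+ binomSum m d
binomSum-pascal m zero    = refl
binomSum-pascal m (suc d) = begin
  binomSum (suc m) (suc (suc d))
    ≡⟨ binomSum-suc (suc m) (suc d) ⟩
  binomSum (suc m) (suc d) ℕ.+ suc m C suc d
    ≡⟨ cong₂ ℕ._+_ (binomSum-pascal m d) (sym (nCk+nC[k+1]≡[n+1]C[k+1] m d)) ⟩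
  binomSum m (suc d) ℕ.+ binomSum m d ℕ.+ (m C d ℕ.+ m C suc d)
    ≡⟨ regroup (binomSum m (suc d)) (binomSum m d) (m C d) (m C suc d) ⟩
  (binomSum m (suc d) ℕ.+ m C suc d) ℕ.+ (binomSum m d ℕ.+ m C d)
    ≡⟨ cong₂ ℕ._+_ (binomSum-suc m (suc d)) (binomSum-suc m d) ⟨
  binomSum m (suc (suc d)) ℕ.+ binomSum m (suc d) ∎
  where
  regroup : ∀ a b c e → a ℕ.+ b ℕ.+ (c ℕ.+ e) ≡ (a ℕ.+ e) ℕ.+ (b ℕ.+ c)
  regroup = ℕ-Solver.solve-∀

dim≡binomSum : ∀ n d → dim n d ≡ binomSum n d
dim≡binomSum n       zero    = refl
dim≡binomSum zero    (suc d) = sym (binomSum-zero d)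
  where
  binomSum-zero : ∀ d → binomSum 0 (suc d) ≡ 1
  binomSum-zero zero    = refl
  binomSum-zero (suc d) = trans (binomSum-suc 0 (suc d)) (cong (ℕ._+ 0) (binomSum-zero d))
dim≡binomSum (suc n) (suc d) =
  trans (cong₂ ℕ._+_ (dim≡binomSum n (suc d)) (dim≡binomSum n d)) (sym (binomSum-pascal n d))

coeffs : ∀ {n d} → Poly n d → Vec ℤ (dim n d)
coeffs {d = zero}      _         = []
coeffs {zero}  {suc d} c         = c ∷ []
coeffs {suc n} {suc d} (p₀ , p₁) = coeffs p₀ ++ coeffs p₁

monomials : ∀ {n} d → Subset n → Vec ℤ (dim n d)
monomials         zero    x       = []
monomials {zero}  (suc d) []      = 1ℤ ∷ []
monomials {suc n} (suc d) (b ∷ x) = monomials (suc d) x ++ Vec.map (indicator b *_) (monomials d x)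

infix 7 _·_ _·ᵥ_

_·_ : ∀ {k} → Vector ℤ k → Vector ℤ k → ℤ
u · v = ∑ (λ i → u i * v i)

_·ᵥ_ : ∀ {k} → Vec ℤ k → Vec ℤ k → ℤ
u ·ᵥ v = Vec.lookup u · Vec.lookup v

·ᵥ-++ : ∀ {k l} (u : Vec ℤ k) (u′ : Vec ℤ l) v v′ → (u ++ u′) ·ᵥ (v ++ v′) ≡ u ·ᵥ v + u′ ·ᵥ v′
·ᵥ-++ []      u′ []      v′ = sym (+-identityˡ (u′ ·ᵥ v′))
·ᵥ-++ (a ∷ u) u′ (b ∷ v) v′ = begin
  a * b + (u ++ u′) ·ᵥ (v ++ v′)     ≡⟨ cong (_+_ (a * b)) (·ᵥ-++ u u′ v v′) ⟩
  a * b + (u ·ᵥ v + u′ ·ᵥ v′)         ≡⟨ +-assoc (a * b) (u ·ᵥ v) (u′ ·ᵥ v′) ⟨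
  a * b + u ·ᵥ v + u′ ·ᵥ v′           ∎

·ᵥ-map-* : ∀ {k} c (u v : Vec ℤ k) → u ·ᵥ Vec.map (c *_) v ≡ c * (u ·ᵥ v)
·ᵥ-map-* c []      []      = sym (*-zeroʳ c)
·ᵥ-map-* c (a ∷ u) (b ∷ v) rewrite ·ᵥ-map-* c u v = pull c a b (u ·ᵥ v)
  where
  pull : ∀ c a b s → a * (c * b) + c * s ≡ c * (a * b + s)
  pull = solve-∀

⟦⟧≡coeffs·ᵥmonomials : ∀ {n d} (p : Poly n d) x → ⟦ p ⟧ x ≡ coeffs p ·ᵥ monomials d x
⟦⟧≡coeffs·ᵥmonomials {d = zero}      p         x       = refl
⟦⟧≡coeffs·ᵥmonomials {zero}  {suc d} c         []      = sym (trans (+-identityʳ (c * 1ℤ)) (*-identityʳ c))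
⟦⟧≡coeffs·ᵥmonomials {suc n} {suc d} (p₀ , p₁) (b ∷ x) = begin
  ⟦ p₀ ⟧ x + indicator b * ⟦ p₁ ⟧ x
    ≡⟨ cong₂ (λ s t → s + indicator b * t) (⟦⟧≡coeffs·ᵥmonomials p₀ x) (⟦⟧≡coeffs·ᵥmonomials p₁ x) ⟩
  coeffs p₀ ·ᵥ monomials (suc d) x + indicator b * (coeffs p₁ ·ᵥ monomials d x)
    ≡⟨ cong (_+_ (coeffs p₀ ·ᵥ monomials (suc d) x)) (·ᵥ-map-* (indicator b) (coeffs p₁) (monomials d x)) ⟨
  coeffs p₀ ·ᵥ monomials (suc d) x + coeffs p₁ ·ᵥ Vec.map (indicator b *_) (monomials d x)
    ≡⟨ ·ᵥ-++ (coeffs p₀) (coeffs p₁) (monomials (suc d) x) (Vec.map (indicator b *_) (monomials d x)) ⟨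
  coeffs (p₀ , p₁) ·ᵥ monomials (suc d) (b ∷ x) ∎

·-removeAt : ∀ {k} (u v : Vector ℤ (suc k)) i → u i ≡ 0ℤ → u · v ≡ removeAt u i · removeAt v i
·-removeAt u v i uᵢ≡0 = begin
  u · v                                        ≡⟨ sum-remove (λ j → u j * v j) ⟩
  u i * v i + removeAt u i · removeAt v i      ≡⟨ cong (λ a → a * v i + removeAt u i · removeAt v i) uᵢ≡0 ⟩
  0ℤ + removeAt u i · removeAt v i             ≡⟨ +-identityˡ _ ⟩
  removeAt u i · removeAt v i                  ∎

·-linearˡ : ∀ {k} a b (u w v : Vector ℤ k) → (λ j → a * u j - b * w j) · v ≡ a * (u · v) - b * (w · v)
·-linearˡ a b u w v = begin
  (λ j → a * u j - b * w j) · v                               ≡⟨ sum-cong-≗ (λ j → expand a b (u j) (w j) (v j)) ⟩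
  ∑ (λ j → a * (u j * v j) + - b * (w j * v j))              ≡⟨ ∑-distrib-+ (λ j → a * (u j * v j)) (λ j → - b * (w j * v j)) ⟩
  ∑ (λ j → a * (u j * v j)) + ∑ (λ j → - b * (w j * v j))  ≡⟨ cong₂ _+_ (*-distribˡ-sum a (λ j → u j * v j)) (*-distribˡ-sum (- b) (λ j → w j * v j)) ⟨
  a * (u · v) + - b * (w · v)                                  ≡⟨ collect a b (u · v) (w · v) ⟩
  a * (u · v) - b * (w · v)                                    ∎
  where
  expand : ∀ a b x y z → (a * x - b * y) * z ≡ a * (x * z) + - b * (y * z)
  expand = solve-∀
  collect : ∀ a b x y → a * x + - b * y ≡ a * x - b * y
  collect = solve-∀

module _ {p : ℕ} (p-prime : Prime p) where

  prime∤* : ∀ {a b} → ¬ + p ∣ℤ a → ¬ + p ∣ℤ b → ¬ + p ∣ℤ a * b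
  prime∤* {a} {b} p∤a p∤b p∣ab with euclidsLemma ℤ.∣ a ∣ ℤ.∣ b ∣ p-prime (subst (p ∣_) (abs-* a b) (∣⇒∣ᵤ p∣ab))
  ... | inj₁ p∣a = p∤a (∣ᵤ⇒∣ p∣a)
  ... | inj₂ p∣b = p∤b (∣ᵤ⇒∣ p∣b)

  prime∤·⇒∃prime∤ : ∀ {k} (u v : Vector ℤ k) → ¬ + p ∣ℤ u · v → ∃ λ i → ¬ + p ∣ℤ u i
  prime∤·⇒∃prime∤ {zero}  u v p∤u·v = contradiction (∣ᵤ⇒∣ (p ∣0)) p∤u·v
  prime∤·⇒∃prime∤ {suc k} u v p∤u·v with + p ∣ℤ? u zero
  ... | no  p∤u₀ = zero , p∤u₀
  ... | yes p∣u₀ with prime∤·⇒∃prime∤ (u ∘ suc) (v ∘ suc) (p∤u·v ∘ ∣m∣n⇒∣m+n (∣m⇒∣m*n (v zero) p∣u₀))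
  ...   | i , p∤uᵢ = suc i , p∤uᵢ

  -- Elimination over 𝔽ₚ: pivot on a coordinate i where u₀ is a unit, clear that coordinate
  -- from the other uₐ and delete it everywhere.
  biorthogonal-mod-prime⇒≤ : ∀ {m k} (u v : Fin m → Vector ℤ k) →
    (∀ a b → a ≢ b → + p ∣ℤ u a · v b) → (∀ a → ¬ + p ∣ℤ u a · v a) → m ≤ k
  biorthogonal-mod-prime⇒≤ {zero}  u v _ _ = z≤n
  biorthogonal-mod-prime⇒≤ {suc m} {k} u v off diag with prime∤·⇒∃prime∤ (u zero) (v zero) (diag zero)
  biorthogonal-mod-prime⇒≤ {suc m} {suc k} u v off diag | i , p∤c = s≤s (biorthogonal-mod-prime⇒≤ u′ v′ off′ diag′)
    where
    c : ℤ
    c = u zero i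
    cleared : Fin m → Vector ℤ (suc k)
    cleared a j = c * u (suc a) j - u (suc a) i * u zero j
    u′ v′ : Fin m → Vector ℤ k
    u′ a = removeAt (cleared a) i
    v′ b = removeAt (v (suc b)) i
    u′·v′ : ∀ a b → u′ a · v′ b ≡ c * (u (suc a) · v (suc b)) - u (suc a) i * (u zero · v (suc b))
    u′·v′ a b = begin
      u′ a · v′ b                 ≡⟨ ·-removeAt (cleared a) (v (suc b)) i (vanish c (u (suc a) i)) ⟨
      cleared a · v (suc b)       ≡⟨ ·-linearˡ c (u (suc a) i) (u (suc a)) (u zero) (v (suc b)) ⟩
      c * (u (suc a) · v (suc b)) - u (suc a) i * (u zero · v (suc b)) ∎
      where
      vanish : ∀ x y → x * y - y * x ≡ 0ℤ
      vanish = solve-∀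
    p∣correction : ∀ a b → + p ∣ℤ u (suc a) i * (u zero · v (suc b))
    p∣correction a b = ∣n⇒∣m*n (u (suc a) i) (off zero (suc b) λ ())
    off′ : ∀ a b → a ≢ b → + p ∣ℤ u′ a · v′ b
    off′ a b a≢b = subst (+ p ∣ℤ_) (sym (u′·v′ a b))
      (∣m∣n⇒∣m-n (∣n⇒∣m*n c (off (suc a) (suc b) (a≢b ∘ suc-injective))) (p∣correction a b))
    diag′ : ∀ a → ¬ + p ∣ℤ u′ a · v′ a
    diag′ a p∣u′·v′ = prime∤* p∤c (diag (suc a))
      (∣m+n∣n⇒∣m (subst (+ p ∣ℤ_) (u′·v′ a a) p∣u′·v′) (∣m⇒∣-m (p∣correction a a)))

polynomial-method : ∀ {p} → Prime p → ∀ {m n d} (f : Fin m → Poly n d) (x : Fin m → Subset n) →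
  (∀ a b → a ≢ b → + p ∣ℤ ⟦ f a ⟧ (x b)) → (∀ a → ¬ + p ∣ℤ ⟦ f a ⟧ (x a)) → m ≤ dim n d
polynomial-method {p} p-prime {m} {n} {d} f x off diag =
  biorthogonal-mod-prime⇒≤ p-prime u v
    (λ a b a≢b → subst (+ p ∣ℤ_) (⟦⟧≡coeffs·ᵥmonomials (f a) (x b)) (off a b a≢b))
    (λ a → diag a ∘ subst (+ p ∣ℤ_) (sym (⟦⟧≡coeffs·ᵥmonomials (f a) (x a))))
  where
  u v : Fin m → Vector ℤ (dim n d)
  u a = Vec.lookup (coeffs (f a))
  v b = Vec.lookup (monomials d (x b))

diffModesˡ diffModesʳ : ∀ {n} → Subset n → Vec Mode n
diffModesˡ = Vec.map λ { true → absent ; false → ignore }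
diffModesʳ = Vec.map λ { true → ignore ; false → present }

count-diffModesˡ : ∀ {n} (A x : Subset n) → count (diffModesˡ A) x ≡ ∣ A ─ x ∣
count-diffModesˡ []          []          = refl
count-diffModesˡ (true  ∷ A) (true  ∷ x) = count-diffModesˡ A x
count-diffModesˡ (true  ∷ A) (false ∷ x) = cong suc (count-diffModesˡ A x)
count-diffModesˡ (false ∷ A) (true  ∷ x) = count-diffModesˡ A x
count-diffModesˡ (false ∷ A) (false ∷ x) = count-diffModesˡ A x

count-diffModesʳ : ∀ {n} (A x : Subset n) → count (diffModesʳ A) x ≡ ∣ x ─ A ∣
count-diffModesʳ []          []          = refl
count-diffModesʳ (true  ∷ A) (true  ∷ x) = count-diffModesʳ A x
count-diffModesʳ (true  ∷ A) (false ∷ x) = count-diffModesʳ A x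
count-diffModesʳ (false ∷ A) (true  ∷ x) = cong suc (count-diffModesʳ A x)
count-diffModesʳ (false ∷ A) (false ∷ x) = count-diffModesʳ A x

-- The first coordinate of A decides whether the separator reads off |A ─ B| or |B ─ A|;
-- either is non-zero mod q for B ≠ A, and this saves the variable x₀.
separator : ∀ {n} r → Subset (suc n) → Poly n (suc r)
separator r (false ∷ A) = altBinomPoly r (diffModesˡ A)
separator r (true  ∷ A) = altBinomPoly r (diffModesʳ A)

⟦separator⟧ : ∀ {n} r (A B : Subset (suc n)) →
  ⟦ separator r A ⟧ (Vec.tail B) ≡ altBinomSum r ∣ A ─ B ∣ ⊎ ⟦ separator r A ⟧ (Vec.tail B) ≡ altBinomSum r ∣ B ─ A ∣
⟦separator⟧ r (false ∷ A) (true  ∷ B) =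
  inj₁ (trans (⟦altBinomPoly⟧ r (diffModesˡ A) B) (cong (altBinomSum r) (count-diffModesˡ A B)))
⟦separator⟧ r (false ∷ A) (false ∷ B) =
  inj₁ (trans (⟦altBinomPoly⟧ r (diffModesˡ A) B) (cong (altBinomSum r) (count-diffModesˡ A B)))
⟦separator⟧ r (true  ∷ A) (true  ∷ B) =
  inj₂ (trans (⟦altBinomPoly⟧ r (diffModesʳ A) B) (cong (altBinomSum r) (count-diffModesʳ A B)))
⟦separator⟧ r (true  ∷ A) (false ∷ B) =
  inj₂ (trans (⟦altBinomPoly⟧ r (diffModesʳ A) B) (cong (altBinomSum r) (count-diffModesʳ A B)))

∣p─p∣≡0 : ∀ {n} (A : Subset n) → ∣ A ─ A ∣ ≡ 0
∣p─p∣≡0 []          = refl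
∣p─p∣≡0 (true  ∷ A) = ∣p─p∣≡0 A
∣p─p∣≡0 (false ∷ A) = ∣p─p∣≡0 A

module ModuloPrimePower {p k r} (p-prime : Prime p) (q≡p^[1+k] : suc r ≡ p ^ suc k) where

  prime∣altBinomSum : ∀ {t} → ¬ suc r ∣ t → + p ∣ℤ altBinomSum r t
  prime∣altBinomSum {zero}  q∤0   = contradiction (suc r ∣0) q∤0
  prime∣altBinomSum {suc s} q∤1+s =
    subst (+ p ∣ℤ_) (sym (altBinomSum-suc r s)) (∣ᵤ⇒∣ (q∤1+s⇒p∣sC[q∸1] {k = k} p-prime q≡p^[1+k] q∤1+s))

  prime∤altBinomSum-zero : ¬ + p ∣ℤ altBinomSum r 0
  prime∤altBinomSum-zero p∣ =
    ¬prime[1] (subst Prime (∣1⇒≡1 (subst (p ∣_) (∣altBinomSum-zero∣≡1 r) (∣⇒∣ᵤ p∣))) p-prime)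

  prime∣⟦separator⟧ : ∀ {n} (A B : Subset (suc n)) → ¬ suc r ∣ ∣ A ─ B ∣ → ¬ suc r ∣ ∣ B ─ A ∣ →
    + p ∣ℤ ⟦ separator r A ⟧ (Vec.tail B)
  prime∣⟦separator⟧ A B q∤∣A─B∣ q∤∣B─A∣ with ⟦separator⟧ r A B
  ... | inj₁ eq = subst (+ p ∣ℤ_) (sym eq) (prime∣altBinomSum q∤∣A─B∣)
  ... | inj₂ eq = subst (+ p ∣ℤ_) (sym eq) (prime∣altBinomSum q∤∣B─A∣)

  prime∤⟦separator⟧-self : ∀ {n} (A : Subset (suc n)) → ¬ + p ∣ℤ ⟦ separator r A ⟧ (Vec.tail A)
  prime∤⟦separator⟧-self A = prime∤altBinomSum-zero ∘ subst (+ p ∣ℤ_) ⟦separator⟧-self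
    where
    ⟦separator⟧-self : ⟦ separator r A ⟧ (Vec.tail A) ≡ altBinomSum r 0
    ⟦separator⟧-self = trans (reduce (⟦separator⟧ r A A)) (cong (altBinomSum r) (∣p─p∣≡0 A))

Unique⇒lookup-injective : ∀ {A : Set} {xs : List A} → Unique xs → ∀ i j → List.lookup xs i ≡ List.lookup xs j → i ≡ j
Unique⇒lookup-injective (_  ∷ _) zero    zero    _  = refl
Unique⇒lookup-injective (x∉ ∷ _) zero    (suc j) eq = contradiction eq (All.lookup x∉ (∈-lookup j))
Unique⇒lookup-injective (x∉ ∷ _) (suc i) zero    eq = contradiction (sym eq) (All.lookup x∉ (∈-lookup i))
Unique⇒lookup-injective (_  ∷ u) (suc i) (suc j) eq = cong suc (Unique⇒lookup-injective u i j eq)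

corollary1p5 : (n : ℕ) → 1 ≤ n → (q : ℕ) → IsPrimePower q →
    (F : List (Subset n)) → Unique F →
    (∀ A B → A ∈ F → B ∈ F → ¬ A ≡ B → ¬ (q ∣ ∣ A ─ B ∣)) →
    length F ≤ binomSum (n ∸ 1) q
corollary1p5 (suc n) _ zero (p , k , p-prime , 0≡p^[1+k]) F _ _ =
  contradiction (subst Prime (m^n≡0⇒m≡0 p (suc k) (sym 0≡p^[1+k])) p-prime) ¬prime[0]
corollary1p5 (suc n) _ (suc r) (p , k , p-prime , q≡p^[1+k]) F unique q∤ =
  subst (length F ≤_) (dim≡binomSum n (suc r))
    (polynomial-method p-prime (separator r ∘ A) (Vec.tail ∘ A) off diag)
  where
  open ModuloPrimePower {k = k} p-prime q≡p^[1+k]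
  A : Fin (length F) → Subset (suc n)
  A = List.lookup F
  off : ∀ a b → a ≢ b → + p ∣ℤ ⟦ separator r (A a) ⟧ (Vec.tail (A b))
  off a b a≢b = prime∣⟦separator⟧ (A a) (A b)
    (q∤ _ _ (∈-lookup a) (∈-lookup b) Aa≢Ab) (q∤ _ _ (∈-lookup b) (∈-lookup a) (Aa≢Ab ∘ sym))
    where
    Aa≢Ab : A a ≢ A b
    Aa≢Ab = a≢b ∘ Unique⇒lookup-injective unique a b
  diag : ∀ a → ¬ + p ∣ℤ ⟦ separator r (A a) ⟧ (Vec.tail (A a))
  diag a = prime∤⟦separator⟧-self (A a)
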